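{- The Diophantine equation $5^{x}-1=L_{r}$ in nonnegative integers $r,x$ has only the solution $(r,x)=(3,1)$.
   Context: $(L_n)_{n\ge0}$ is the Lucas sequence: $L_0=2$, $L_1=1$, $L_n=L_{n-1}+L_{n-2}$ for $n\ge 2$. -}

module Defs where

open import Data.Nat using (ℕ; zero; suc; _+_)

L : ℕ → ℕ
L zero = 2
L (suc zero) = 1
L (suc (suc n)) = L (suc n) + L n

module Submission where

-- The exponents x = 0 and x = 1 are settled by the size of the Lucas numbers
-- (L r ≥ 1 for all r, and L r ≥ 7 once r ≥ 4).  For x ≥ 2 the equation
-- L r + 1 = 5 ^ x is impossible modulo 275 = 5² · 11:
--   * the Lucas sequence modulo 275 is periodic with period 20, because the
--     pair (L 20 , L 21) is congruent to (L 0 , L 1) and the recurrence is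
--     preserved by reduction modulo any m;
--   * the powers 5 ^ (y + 2) modulo 275 are periodic in y with period 5,
--     because 5 ^ 7 ≡ 5 ^ 2;
--   * so both sides only take finitely many residues, and a finite
--     computation shows that L i + 1 ≢ 5 ^ (j + 2) modulo 275 for i < 20,
--     j < 5.
-- The general facts (congruence is compatible with + and *, periodic
-- functions factor through _% p, periodicity criteria for Lucas numbers and
-- powers) are proved first for an arbitrary modulus and period.

open import Defs
open import Data.Nat using (ℕ; zero; suc; _+_; _*_; _^_; _∸_; _≤_; _<_; s≤s; z≤n; NonZero; _≟_)
open import Data.Nat.Properties using (≤-trans; m≤m+n; m∸n+n≡m; m^n>0; +-comm; +-assoc; allUpTo?)
open import Data.Nat.DivMod using (_%_; _/_; %-distribˡ-+; %-distribˡ-*; m≡m%n+[m/n]*n; m%n<n)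
open import Data.Product using (_×_; _,_)
open import Data.Empty using (⊥-elim)
open import Relation.Nullary using (¬_; ¬?)
open import Relation.Nullary.Decidable using (toWitness)
open import Relation.Binary.PropositionalEquality
  using (_≡_; _≢_; refl; sym; cong; cong₂; subst; module ≡-Reasoning)
open import Function.Bundles using (_⇔_; mk⇔)

open ≡-Reasoning

+-cong-mod : ∀ {a a′ b b′} d .{{_ : NonZero d}} →
             a % d ≡ a′ % d → b % d ≡ b′ % d → (a + b) % d ≡ (a′ + b′) % d
+-cong-mod {a} {a′} {b} {b′} d ea eb = begin
  (a + b) % d              ≡⟨ %-distribˡ-+ a b d ⟩
  (a % d + b % d) % d      ≡⟨ cong₂ (λ u v → (u + v) % d) ea eb ⟩
  (a′ % d + b′ % d) % d    ≡⟨ %-distribˡ-+ a′ b′ d ⟨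
  (a′ + b′) % d            ∎

*-cong-mod : ∀ c {a a′} d .{{_ : NonZero d}} →
             a % d ≡ a′ % d → (c * a) % d ≡ (c * a′) % d
*-cong-mod c {a} {a′} d ea = begin
  (c * a) % d              ≡⟨ %-distribˡ-* c a d ⟩
  (c % d * (a % d)) % d    ≡⟨ cong (λ u → (c % d * u) % d) ea ⟩
  (c % d * (a′ % d)) % d   ≡⟨ %-distribˡ-* c a′ d ⟨
  (c * a′) % d             ∎

periodic⇒mod : (f : ℕ → ℕ) (p : ℕ) .{{_ : NonZero p}} →
               (∀ n → f (n + p) ≡ f n) → ∀ n → f n ≡ f (n % p)
periodic⇒mod f p period n = begin
  f n                         ≡⟨ cong f (m≡m%n+[m/n]*n n p) ⟩
  f (n % p + (n / p) * p)     ≡⟨ shift (n % p) (n / p) ⟩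
  f (n % p)                   ∎
  where
  shift : ∀ m k → f (m + k * p) ≡ f m
  shift m zero    = cong f (+-comm m 0)
  shift m (suc k) = begin
    f (m + (p + k * p))   ≡⟨ cong f (+-comm m (p + k * p)) ⟩
    f ((p + k * p) + m)   ≡⟨ cong f (+-assoc p (k * p) m) ⟩
    f (p + (k * p + m))   ≡⟨ cong f (+-comm p (k * p + m)) ⟩
    f ((k * p + m) + p)   ≡⟨ period (k * p + m) ⟩
    f (k * p + m)         ≡⟨ cong f (+-comm (k * p) m) ⟩
    f (m + k * p)         ≡⟨ shift m k ⟩
    f m                   ∎

-- The Lucas sequence modulo m has period p as soon as its first two terms
-- recur at indices p and p + 1, since the recurrence survives reduction mod m.
lucas-periodic : ∀ m .{{_ : NonZero m}} p →
                 L p % m ≡ L 0 % m → L (suc p) % m ≡ L 1 % m →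
                 ∀ n → L (n + p) % m ≡ L n % m
lucas-periodic m p e₀ e₁ zero          = e₀
lucas-periodic m p e₀ e₁ (suc zero)    = e₁
lucas-periodic m p e₀ e₁ (suc (suc n)) =
  +-cong-mod m (lucas-periodic m p e₀ e₁ (suc n)) (lucas-periodic m p e₀ e₁ n)

power-periodic : ∀ b k m .{{_ : NonZero m}} p →
                 b ^ (p + k) % m ≡ b ^ k % m →
                 ∀ x → b ^ (x + p + k) % m ≡ b ^ (x + k) % m
power-periodic b k m p e zero    = e
power-periodic b k m p e (suc x) = *-cong-mod b m (power-periodic b k m p e x)

lucas-mod-275 : ∀ r → L r % 275 ≡ L (r % 20) % 275
lucas-mod-275 = periodic⇒mod (λ n → L n % 275) 20 (lucas-periodic 275 20 refl refl)

power-mod-275 : ∀ y → 5 ^ (y + 2) % 275 ≡ 5 ^ (y % 5 + 2) % 275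
power-mod-275 = periodic⇒mod (λ y → 5 ^ (y + 2) % 275) 5 periodic
  where
  periodic : ∀ y → 5 ^ (y + 5 + 2) % 275 ≡ 5 ^ (y + 2) % 275
  periodic = power-periodic 5 2 275 5 refl

no-collision : ∀ {i} → i < 20 → ∀ {j} → j < 5 → (L i + 1) % 275 ≢ 5 ^ (j + 2) % 275
no-collision = toWitness {a? = allUpTo? (λ i → allUpTo? (λ j → ¬? ((L i + 1) % 275 ≟ 5 ^ (j + 2) % 275)) 5) 20} _

no-large-solution : ∀ r y → L r + 1 ≢ 5 ^ (y + 2)
no-large-solution r y e = no-collision (m%n<n r 20) (m%n<n y 5) (begin
  (L (r % 20) + 1) % 275   ≡⟨ +-cong-mod {L (r % 20)} {L r} {1} {1} 275 (sym (lucas-mod-275 r)) refl ⟩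
  (L r + 1) % 275          ≡⟨ cong (_% 275) e ⟩
  5 ^ (y + 2) % 275        ≡⟨ power-mod-275 y ⟩
  5 ^ (y % 5 + 2) % 275    ∎)

lucas-positive : ∀ r → 1 ≤ L r
lucas-positive zero          = s≤s z≤n
lucas-positive (suc zero)    = s≤s z≤n
lucas-positive (suc (suc r)) = ≤-trans (lucas-positive (suc r)) (m≤m+n _ _)

lucas-≥7 : ∀ n → 7 ≤ L (4 + n)
lucas-≥7 zero    = s≤s (s≤s (s≤s (s≤s (s≤s (s≤s (s≤s z≤n))))))
lucas-≥7 (suc n) = ≤-trans (lucas-≥7 n) (m≤m+n _ _)

lucas≡4 : ∀ r → 4 ≡ L r → r ≡ 3
lucas≡4 zero                      ()
lucas≡4 (suc zero)                ()
lucas≡4 (suc (suc zero))          ()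
lucas≡4 (suc (suc (suc zero)))    _ = refl
lucas≡4 (suc (suc (suc (suc n)))) e = ⊥-elim (7≰4 (subst (7 ≤_) (sym e) (lucas-≥7 n)))
  where
  7≰4 : ¬ (7 ≤ 4)
  7≰4 (s≤s (s≤s (s≤s (s≤s ()))))

solutions : ∀ r x → 5 ^ x ∸ 1 ≡ L r → (r ≡ 3) × (x ≡ 1)
solutions r zero          e = ⊥-elim (1≰0 (subst (1 ≤_) (sym e) (lucas-positive r)))
  where
  1≰0 : ¬ (1 ≤ 0)
  1≰0 ()
solutions r (suc zero)    e = lucas≡4 r e , refl
solutions r (suc (suc y)) e = ⊥-elim (no-large-solution r y (begin
  L r + 1                   ≡⟨ cong (_+ 1) e ⟨
  5 ^ (2 + y) ∸ 1 + 1       ≡⟨ m∸n+n≡m (m^n>0 5 (2 + y)) ⟩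
  5 ^ (2 + y)               ≡⟨ cong (5 ^_) (+-comm 2 y) ⟩
  5 ^ (y + 2)               ∎))

corollary7 : (r x : ℕ) → (5 ^ x ∸ 1 ≡ L r) ⇔ ((r ≡ 3) × (x ≡ 1))
corollary7 r x = mk⇔ (solutions r x) is-solution
  where
  is-solution : (r ≡ 3) × (x ≡ 1) → 5 ^ x ∸ 1 ≡ L r
  is-solution (refl , refl) = refl
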